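{- Let $M=(E,\mathcal{B})$ be an antisymmetric matroid on $E=[n]\cup[n]^*$ and let $P_M\subseteq\mathbb{R}^n$ be the convex hull of $\{\mathbf{e}_B:B\in\mathcal{B}\}$. For each $B\in\mathcal{B}$, the vector $\mathbf{e}_B$ is a vertex of $P_M$ if and only if $B$ is a transversal. In particular, $P_M$ equals the convex hull of $\{\mathbf{e}_B:B\in\mathcal{B}\cap\mathcal{T}_n\}$.
   Context: $E=[n]\cup[n]^*$ with involution $i\leftrightarrow i^*$; a skew pair is $\{i,i^*\}$; $\mathcal{T}_n$ (transversals) are $n$-subsets of $E$ with no skew pair, $\mathcal{A}_n$ (almost-transversals) $n$-subsets with exactly one skew pair. An antisymmetric matroid on $E$ is $(E,\mathcal{B})$ with $\mathcal{B}\subseteq\mathcal{T}_n\cup\mathcal{A}_n$ satisfying (B1) $\mathcal{B}\ne\emptyset$; (B2) for $T\in\mathcal{T}_n$ and distinct skew pairs $p,q$, $(T\cup p)\setminus q\in\mathcal{B}$ iff $(T\cup q)\setminus p\in\mathcal{B}$; (Exch) for $B,B'\in\mathcal{B}$ and $e\in B\setminus B'$ with $B\setminus\{e\}$ having no skew pair and $B'\cup\{e\}$ having exactly one skew pair, there is $f\in B'\setminus B$ with both $(B\setminus\{e\})\cup\{f\}$ and $(B'\cup\{e\})\setminus\{f\}$ in $\mathcal{B}$. Let $\mathbf{e}_1,\dots,\mathbf{e}_n$ be the standard basis of $\mathbb{R}^n$, set $\mathbf{e}_{i^*}:=-\mathbf{e}_i$, and for $S\subseteq E$ let $\mathbf{e}_S:=\sum_{s\in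 S}\mathbf{e}_s$.
   Formalization: The polytope $P_M$, its vertices and the equality of hulls are taken in ℚ^n rather than ℝ^n, with rational coordinates for points and rational coefficients in convex combinations. -}

module Defs where

open import Data.Bool using (Bool; true; false; _∧_; if_then_else_)
open import Data.Nat as ℕ using (ℕ; zero; suc)
open import Data.Fin using (Fin)
open import Data.Vec using (Vec; lookup; updateAt; foldr)
open import Data.Vec as V using ()
open import Data.Product using (_×_; _,_; ∃; ∃-syntax; proj₁; proj₂)
open import Data.List as L using (List)
open import Data.List.Relation.Unary.All using (All)
open import Data.Rational as ℚ using (ℚ; 0ℚ; 1ℚ)
open import Relation.Binary.PropositionalEquality using (_≡_)
open import Relation.Nullary using (¬_)
open import Function.Bundles using (_⇔_)
open import Data.Sum using (_⊎_)

-- Ground set E = [n] ∪ [n]* : the element (i , false) is i, (i , true) is i*.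
Elt : ℕ → Set
Elt n = Fin n × Bool

star : ∀ {n} → Elt n → Elt n
star (i , false) = (i , true)
star (i , true)  = (i , false)

-- A subset S of E: position i records (i ∈ S , i* ∈ S).
SubE : ℕ → Set
SubE n = Vec (Bool × Bool) n

memb : ∀ {n} → Elt n → SubE n → Bool
memb (i , false) S = proj₁ (lookup S i)
memb (i , true)  S = proj₂ (lookup S i)

_∈E_ : ∀ {n} → Elt n → SubE n → Set
e ∈E S = memb e S ≡ true

_∉E_ : ∀ {n} → Elt n → SubE n → Set
e ∉E S = memb e S ≡ false

insert : ∀ {n} → Elt n → SubE n → SubE n
insert (i , false) S = updateAt S i (λ p → (true , proj₂ p))
insert (i , true)  S = updateAt S i (λ p → (proj₁ p , true))

remove : ∀ {n} → Elt n → SubE n → SubE n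
remove (i , false) S = updateAt S i (λ p → (false , proj₂ p))
remove (i , true)  S = updateAt S i (λ p → (proj₁ p , false))

addPair : ∀ {n} → Fin n → SubE n → SubE n
addPair i S = updateAt S i (λ _ → (true , true))

removePair : ∀ {n} → Fin n → SubE n → SubE n
removePair i S = updateAt S i (λ _ → (false , false))

bit : Bool → ℕ
bit true  = 1
bit false = 0

size : ∀ {n} → SubE n → ℕ
size S = foldr _ (λ p acc → bit (proj₁ p) ℕ.+ bit (proj₂ p) ℕ.+ acc) 0 S

skewCount : ∀ {n} → SubE n → ℕ
skewCount S = foldr _ (λ p acc → bit (proj₁ p ∧ proj₂ p) ℕ.+ acc) 0 S

IsTransversal : ∀ {n} → SubE n → Set
IsTransversal {n} S = (size S ≡ n) × (skewCount S ≡ 0)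

IsAlmostTransversal : ∀ {n} → SubE n → Set
IsAlmostTransversal {n} S = (size S ≡ n) × (skewCount S ≡ 1)

record AntisymmetricMatroid (n : ℕ) : Set₁ where
  field
    𝓑 : SubE n → Set
    bases-⊆ : ∀ S → 𝓑 S → IsTransversal S ⊎ IsAlmostTransversal S
    B1 : ∃[ S ] 𝓑 S
    B2 : ∀ (T : SubE n) → IsTransversal T → (p q : Fin n) → ¬ (p ≡ q) →
         𝓑 (removePair q (addPair p T)) ⇔ 𝓑 (removePair p (addPair q T))
    Exch : ∀ B B' → 𝓑 B → 𝓑 B' → (e : Elt n) → e ∈E B → e ∉E B' →
           skewCount (remove e B) ≡ 0 → skewCount (insert e B') ≡ 1 →
           ∃[ f ] (f ∈E B' × f ∉E B ×
                   𝓑 (insert f (remove e B)) × 𝓑 (remove f (insert e B')))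

Point : ℕ → Set
Point n = Fin n → ℚ

boolℚ : Bool → ℚ
boolℚ true  = 1ℚ
boolℚ false = 0ℚ

-- e_S = Σ_{s ∈ S} e_s with e_{i*} = - e_i
eVec : ∀ {n} → SubE n → Point n
eVec S i = boolℚ (proj₁ (lookup S i)) ℚ.- boolℚ (proj₂ (lookup S i))

record InHull {n} (G : SubE n → Set) (x : Point n) : Set where
  field
    terms   : List (ℚ × SubE n)
    gens    : All (λ t → G (proj₂ t)) terms
    nonneg  : All (λ t → 0ℚ ℚ.≤ proj₁ t) terms
    sum-one : L.foldr (λ t acc → proj₁ t ℚ.+ acc) 0ℚ terms ≡ 1ℚ
    combo   : ∀ i → L.foldr (λ t acc → proj₁ t ℚ.* eVec (proj₂ t) i ℚ.+ acc) 0ℚ terms ≡ x i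

IsVertex : ∀ {n} → (SubE n → Set) → Point n → Set
IsVertex G v =
  InHull G v ×
  (∀ (x y : Point _) (t : ℚ) → InHull G x → InHull G y →
     0ℚ ℚ.< t → t ℚ.< 1ℚ →
     (∀ i → v i ≡ t ℚ.* x i ℚ.+ (1ℚ ℚ.- t) ℚ.* y i) →
     ∀ i → x i ≡ y i)

TransversalBases : ∀ {n} → AntisymmetricMatroid n → SubE n → Set
TransversalBases M S = AntisymmetricMatroid.𝓑 M S × IsTransversal S

{-# OPTIONS --safe #-}

-- An almost-transversal basis B contains a skew pair {p, p*} and is disjoint from another pair
-- {q, q*}.  T = (B ∖ p*) ∪ q is a transversal with B = (T ∪ {p, p*}) ∖ {q, q*}, so by (B2)
-- B′ = (T ∪ {q, q*}) ∖ {p, p*} is a basis.  Exchanging p between B and B′ yields f ∈ {q, q*}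
-- such that X = (B ∖ p) ∪ f and Y = (B′ ∪ p) ∖ f are bases without skew pair, hence transversal.
-- Coordinatewise e_B = ½ e_X + ½ e_Y, while e_X and e_Y differ at p: so e_B is not a vertex, and
-- in any convex combination it can be replaced by ½ e_X + ½ e_Y.  Conversely, all coordinates of
-- e_T for a transversal T are ±1, the extreme values of the cube [-1, 1]ⁿ containing P_M.

module Submission where

open import Defs
open import Data.Nat using (ℕ)
open import Data.Product using (_×_)
open import Function.Bundles using (_⇔_)

open import Data.Bool using (Bool; true; false; _∧_)
open import Data.Fin using (Fin; zero; suc; _≟_)
open import Data.List using (List; []; _∷_; foldr)
open import Data.List.Relation.Unary.All as All using (All; []; _∷_)
open import Data.Nat as ℕ using (suc)
import Data.Nat.Properties as ℕₚ
open import Data.Product as Product using (_,_; proj₁; proj₂; ∃-syntax)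
open import Data.Rational as ℚ using (ℚ; 0ℚ; 1ℚ; ½; _+_; _*_; -_; _-_; _≤_; _<_)
import Data.Rational.Properties as ℚₚ
import Data.Rational.Solver as ℚ-Solver
open import Data.Sum using (_⊎_; inj₁; inj₂)
open import Data.Vec as Vec using (Vec; []; _∷_; lookup; updateAt)
open import Data.Vec.Properties using (lookup∘updateAt; lookup∘updateAt′; tabulate∘lookup; tabulate-cong)
open import Function.Base using (_∘′_)
open import Function.Bundles using (mk⇔; Equivalence)
open import Relation.Binary.PropositionalEquality
open import Relation.Nullary using (yes; no; contradiction)
open import Relation.Nullary.Decidable using (from-yes)

open import Algebra.Properties.CommutativeSemigroup ℕₚ.+-commutativeSemigroup
  using (x∙yz≈y∙xz; interchange)

Entry : Set
Entry = Bool × Bool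

ev : Entry → ℚ
ev e = boolℚ (proj₁ e) - boolℚ (proj₂ e)

sizeWeight skewWeight gapWeight : Entry → ℕ
sizeWeight e = bit (proj₁ e) ℕ.+ bit (proj₂ e)
skewWeight e = bit (proj₁ e ∧ proj₂ e)
gapWeight (false , false) = 1
gapWeight _               = 0

count : ∀ {A : Set} {m} → (A → ℕ) → Vec A m → ℕ
count w = Vec.foldr _ (λ x acc → w x ℕ.+ acc) 0

gapCount : ∀ {n} → SubE n → ℕ
gapCount = count gapWeight

count-updateAt : ∀ {A : Set} {m} (w : A → ℕ) (xs : Vec A m) i (f : A → A) {x} →
  lookup xs i ≡ x → w x ℕ.+ count w (updateAt xs i f) ≡ w (f x) ℕ.+ count w xs
count-updateAt w (y ∷ ys) zero    f refl = x∙yz≈y∙xz (w y) (w (f y)) (count w ys)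
count-updateAt w (y ∷ ys) (suc i) f {x} eq = begin
  w x ℕ.+ (w y ℕ.+ count w (updateAt ys i f)) ≡⟨ x∙yz≈y∙xz (w x) (w y) _ ⟩
  w y ℕ.+ (w x ℕ.+ count w (updateAt ys i f)) ≡⟨ cong (w y ℕ.+_) (count-updateAt w ys i f eq) ⟩
  w y ℕ.+ (w (f x) ℕ.+ count w ys)            ≡⟨ x∙yz≈y∙xz (w y) (w (f x)) _ ⟩
  w (f x) ℕ.+ (w y ℕ.+ count w ys)            ∎
  where open ≡-Reasoning

count≡0⇒ : ∀ {A : Set} {m} (w : A → ℕ) (xs : Vec A m) → count w xs ≡ 0 → ∀ i → w (lookup xs i) ≡ 0
count≡0⇒ w (y ∷ ys) h zero    = ℕₚ.m+n≡0⇒m≡0 (w y) h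
count≡0⇒ w (y ∷ ys) h (suc i) = count≡0⇒ w ys (ℕₚ.m+n≡0⇒n≡0 (w y) h) i

count≢0⇒ : ∀ {A : Set} {m} (w : A → ℕ) (xs : Vec A m) → count w xs ≢ 0 → ∃[ i ] w (lookup xs i) ≢ 0
count≢0⇒ w []       h = contradiction refl h
count≢0⇒ w (y ∷ ys) h with w y in eq
... | suc _ = zero , λ w≡0 → ℕₚ.1+n≢0 (trans (sym eq) w≡0)
... | 0     = let i , w≢0 = count≢0⇒ w ys h in suc i , w≢0

size+gapCount≡n+skewCount : ∀ {n} (S : SubE n) → size S ℕ.+ gapCount S ≡ n ℕ.+ skewCount S
size+gapCount≡n+skewCount []      = refl
size+gapCount≡n+skewCount {suc n} (e ∷ S) = begin
  (sizeWeight e ℕ.+ size S) ℕ.+ (gapWeight e ℕ.+ gapCount S)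
    ≡⟨ interchange (sizeWeight e) (size S) (gapWeight e) (gapCount S) ⟩
  (sizeWeight e ℕ.+ gapWeight e) ℕ.+ (size S ℕ.+ gapCount S)
    ≡⟨ cong₂ ℕ._+_ (entry e) (size+gapCount≡n+skewCount S) ⟩
  suc (skewWeight e ℕ.+ (n ℕ.+ skewCount S))
    ≡⟨ cong suc (x∙yz≈y∙xz (skewWeight e) n _) ⟩
  suc n ℕ.+ (skewWeight e ℕ.+ skewCount S)
    ∎
  where
  open ≡-Reasoning
  entry : ∀ e → sizeWeight e ℕ.+ gapWeight e ≡ suc (skewWeight e)
  entry (true  , true ) = refl
  entry (true  , false) = refl
  entry (false , true ) = refl
  entry (false , false) = refl

gapCount≡skewCount : ∀ {n} (S : SubE n) → size S ≡ n → gapCount S ≡ skewCount S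
gapCount≡skewCount {n} S size≡n =
  ℕₚ.+-cancelˡ-≡ n _ _ (trans (cong (ℕ._+ gapCount S) (sym size≡n)) (size+gapCount≡n+skewCount S))

transversal-coordinate : ∀ {n} {S : SubE n} → IsTransversal S → ∀ i → eVec S i ≡ 1ℚ ⊎ eVec S i ≡ - 1ℚ
transversal-coordinate {S = S} (size≡n , noSkew) i =
  single (lookup S i) (count≡0⇒ skewWeight S noSkew i)
         (count≡0⇒ gapWeight S (trans (gapCount≡skewCount S size≡n) noSkew) i)
  where
  single : ∀ e → skewWeight e ≡ 0 → gapWeight e ≡ 0 → ev e ≡ 1ℚ ⊎ ev e ≡ - 1ℚ
  single (true  , false) _ _ = inj₁ refl
  single (false , true ) _ _ = inj₂ refl

almostTransversal-skewPair : ∀ {n} (S : SubE n) → IsAlmostTransversal S → ∃[ p ] lookup S p ≡ (true , true)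
almostTransversal-skewPair S (_ , oneSkew) with count≢0⇒ skewWeight S (λ h → ℕₚ.1+n≢0 (trans (sym oneSkew) h))
... | p , w≢0 = p , skew (lookup S p) w≢0
  where
  skew : ∀ e → skewWeight e ≢ 0 → e ≡ (true , true)
  skew (true  , true ) _   = refl
  skew (true  , false) w≢0 = contradiction refl w≢0
  skew (false , _    ) w≢0 = contradiction refl w≢0

almostTransversal-gap : ∀ {n} (S : SubE n) → IsAlmostTransversal S → ∃[ q ] lookup S q ≡ (false , false)
almostTransversal-gap S (size≡n , oneSkew)
  with count≢0⇒ gapWeight S (λ h → ℕₚ.1+n≢0 (trans (sym (trans (gapCount≡skewCount S size≡n) oneSkew)) h))
... | q , w≢0 = q , gap (lookup S q) w≢0
  where
  gap : ∀ e → gapWeight e ≢ 0 → e ≡ (false , false)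
  gap (false , false) _   = refl
  gap (false , true ) w≢0 = contradiction refl w≢0
  gap (true  , _    ) w≢0 = contradiction refl w≢0

memb-cong : ∀ {n} {S S' : SubE n} {k} s → lookup S k ≡ lookup S' k → memb (k , s) S ≡ memb (k , s) S'
memb-cong false eq = cong proj₁ eq
memb-cong true  eq = cong proj₂ eq

gap-∉ : ∀ {n} {S : SubE n} {k} s → lookup S k ≡ (false , false) → (k , s) ∉E S
gap-∉ false eq = cong proj₁ eq
gap-∉ true  eq = cong proj₂ eq

module Patch {n} (B : SubE n) {p q : Fin n} (p≢q : p ≢ q) where

  record Patched (S : SubE n) (a b : Entry) : Set where
    field
      at-p      : lookup S p ≡ a
      at-q      : lookup S q ≡ b
      elsewhere : ∀ {j} → j ≢ p → j ≢ q → lookup S j ≡ lookup B j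

  open Patched public

  patched-updateAt-p : ∀ {S a b} → Patched S a b → (f : Entry → Entry) → Patched (updateAt S p f) (f a) b
  patched-updateAt-p {S} P f = record
    { at-p      = trans (lookup∘updateAt p S) (cong f (at-p P))
    ; at-q      = trans (lookup∘updateAt′ q p (p≢q ∘′ sym) S) (at-q P)
    ; elsewhere = λ j≢p j≢q → trans (lookup∘updateAt′ _ p j≢p S) (elsewhere P j≢p j≢q)
    }

  patched-updateAt-q : ∀ {S a b} → Patched S a b → (f : Entry → Entry) → Patched (updateAt S q f) a (f b)
  patched-updateAt-q {S} P f = record
    { at-p      = trans (lookup∘updateAt′ p q p≢q S) (at-p P)
    ; at-q      = trans (lookup∘updateAt q S) (cong f (at-q P))
    ; elsewhere = λ j≢p j≢q → trans (lookup∘updateAt′ _ q j≢q S) (elsewhere P j≢p j≢q)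
    }

  patched-lookup : ∀ {S S' a b} → Patched S a b → Patched S' a b → ∀ j → lookup S j ≡ lookup S' j
  patched-lookup P P' j with j ≟ p | j ≟ q
  ... | yes refl | _        = trans (at-p P) (sym (at-p P'))
  ... | no _     | yes refl = trans (at-q P) (sym (at-q P'))
  ... | no j≢p   | no j≢q   = trans (elsewhere P j≢p j≢q) (sym (elsewhere P' j≢p j≢q))

  patched-unique : ∀ {S S' a b} → Patched S a b → Patched S' a b → S ≡ S'
  patched-unique {S} {S'} P P' =
    trans (sym (tabulate∘lookup S)) (trans (tabulate-cong (patched-lookup P P')) (tabulate∘lookup S'))

  patched-count : ∀ (w : Entry → ℕ) {S S' a b a' b'} → Patched S a b → Patched S' a' b' →
    w a' ℕ.+ w b' ℕ.+ count w S ≡ w a ℕ.+ w b ℕ.+ count w S'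
  patched-count w {S} {S'} {a} {b} {a'} {b'} P P' = begin
    w a' ℕ.+ w b' ℕ.+ count w S     ≡⟨ cong (λ V → w a' ℕ.+ w b' ℕ.+ count w V) (patched-unique P P₂) ⟩
    w a' ℕ.+ w b' ℕ.+ count w S₂    ≡⟨ ℕₚ.+-assoc (w a') (w b') _ ⟩
    w a' ℕ.+ (w b' ℕ.+ count w S₂)  ≡⟨ cong (w a' ℕ.+_) (count-updateAt w S₁ q _ (at-q P₁)) ⟩
    w a' ℕ.+ (w b ℕ.+ count w S₁)   ≡⟨ x∙yz≈y∙xz (w a') (w b) _ ⟩
    w b ℕ.+ (w a' ℕ.+ count w S₁)   ≡⟨ cong (w b ℕ.+_) (count-updateAt w S' p _ (at-p P')) ⟩
    w b ℕ.+ (w a ℕ.+ count w S')    ≡⟨ x∙yz≈y∙xz (w b) (w a) _ ⟩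
    w a ℕ.+ (w b ℕ.+ count w S')    ≡⟨ ℕₚ.+-assoc (w a) (w b) _ ⟨
    w a ℕ.+ w b ℕ.+ count w S'      ∎
    where
    open ≡-Reasoning
    P₁ = patched-updateAt-p P' (λ _ → a)
    P₂ = patched-updateAt-q P₁ (λ _ → b)
    S₁ = updateAt S' p (λ _ → a)
    S₂ = updateAt S₁ q (λ _ → b)

  patched-midpoint : ∀ {Z X Y z₁ z₂ x₁ x₂ y₁ y₂} →
    Patched Z z₁ z₂ → Patched X x₁ x₂ → Patched Y y₁ y₂ →
    ev z₁ ≡ ½ * ev x₁ + ½ * ev y₁ → ev z₂ ≡ ½ * ev x₂ + ½ * ev y₂ →
    ∀ j → eVec Z j ≡ ½ * eVec X j + ½ * eVec Y j
  patched-midpoint PZ PX PY mid-p mid-q j with j ≟ p | j ≟ q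
  ... | yes refl | _        rewrite at-p PZ | at-p PX | at-p PY = mid-p
  ... | no _     | yes refl rewrite at-q PZ | at-q PX | at-q PY = mid-q
  ... | no j≢p   | no j≢q   rewrite elsewhere PZ j≢p j≢q | elsewhere PX j≢p j≢q | elsewhere PY j≢p j≢q =
    halves (eVec B j)
    where
    halves : ∀ x → x ≡ ½ * x + ½ * x
    halves = solve 1 (λ x → x := con ½ :* x :+ con ½ :* x) refl
      where open ℚ-Solver.+-*-Solver

  patched-new-element : ∀ {S a b k s} → Patched S a b → (k , s) ∈E S → (k , s) ∉E B → k ≡ p ⊎ k ≡ q
  patched-new-element {k = k} {s} P k∈S k∉B with k ≟ p | k ≟ q
  ... | yes k≡p | _       = inj₁ k≡p
  ... | no _    | yes k≡q = inj₂ k≡q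
  ... | no k≢p  | no k≢q  =
    contradiction (trans (sym k∈S) (trans (memb-cong s (elsewhere P k≢p k≢q)) k∉B)) λ ()

weight : ∀ {n} → List (ℚ × SubE n) → ℚ
weight = foldr (λ t acc → proj₁ t + acc) 0ℚ

combination : ∀ {n} → Fin n → List (ℚ × SubE n) → ℚ
combination i = foldr (λ t acc → proj₁ t * eVec (proj₂ t) i + acc) 0ℚ

NonNegativeWeights : ∀ {n} → List (ℚ × SubE n) → Set
NonNegativeWeights = All (λ t → 0ℚ ≤ proj₁ t)

inHull-singleton : ∀ {n} {G : SubE n → Set} {S} → G S → InHull G (eVec S)
inHull-singleton {S = S} S∈G = record
  { terms   = (1ℚ , S) ∷ []
  ; gens    = S∈G ∷ []
  ; nonneg  = from-yes (0ℚ ℚ.≤? 1ℚ) ∷ []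
  ; sum-one = refl
  ; combo   = λ i → trans (ℚₚ.+-identityʳ _) (ℚₚ.*-identityˡ _)
  }

inHull-mono : ∀ {n} {G H : SubE n → Set} → (∀ {S} → G S → H S) → ∀ {x} → InHull G x → InHull H x
inHull-mono G⊆H h = record
  { terms = terms ; gens = All.map G⊆H gens ; nonneg = nonneg ; sum-one = sum-one ; combo = combo }
  where open InHull h

ev-bounded : ∀ e → - 1ℚ ≤ ev e × ev e ≤ 1ℚ
ev-bounded (true  , true ) = from-yes (- 1ℚ ℚ.≤? 0ℚ) , from-yes (0ℚ ℚ.≤? 1ℚ)
ev-bounded (true  , false) = from-yes (- 1ℚ ℚ.≤? 1ℚ) , ℚₚ.≤-refl
ev-bounded (false , true ) = ℚₚ.≤-refl , from-yes (- 1ℚ ℚ.≤? 1ℚ)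
ev-bounded (false , false) = from-yes (- 1ℚ ℚ.≤? 0ℚ) , from-yes (0ℚ ℚ.≤? 1ℚ)

scaled-bounded : ∀ {l a} → 0ℚ ≤ l → - 1ℚ ≤ a × a ≤ 1ℚ → - l ≤ l * a × l * a ≤ l
scaled-bounded {l} {a} 0≤l (-1≤a , a≤1) =
  subst (_≤ l * a) l*-1≡-l (ℚₚ.*-monoˡ-≤-nonNeg l -1≤a) ,
  subst (l * a ≤_) (ℚₚ.*-identityʳ l) (ℚₚ.*-monoˡ-≤-nonNeg l a≤1)
  where
  instance _ = ℚ.nonNegative 0≤l
  l*-1≡-l : l * - 1ℚ ≡ - l
  l*-1≡-l = trans (sym (ℚₚ.neg-distribʳ-* l 1ℚ)) (cong -_ (ℚₚ.*-identityʳ l))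

combination-bounded : ∀ {n} i (ts : List (ℚ × SubE n)) → NonNegativeWeights ts →
  - weight ts ≤ combination i ts × combination i ts ≤ weight ts
combination-bounded i []             []          = ℚₚ.≤-refl , ℚₚ.≤-refl
combination-bounded i ((l , S) ∷ ts) (0≤l ∷ 0≤ts) =
  subst (_≤ combination i ((l , S) ∷ ts)) (sym (ℚₚ.neg-distrib-+ l (weight ts)))
    (ℚₚ.+-mono-≤ (proj₁ head) (proj₁ tail)) ,
  ℚₚ.+-mono-≤ (proj₂ head) (proj₂ tail)
  where
  head = scaled-bounded 0≤l (ev-bounded (lookup S i))
  tail = combination-bounded i ts 0≤ts

inHull-bounded : ∀ {n} {G : SubE n → Set} {x} → InHull G x → ∀ i → - 1ℚ ≤ x i × x i ≤ 1ℚ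
inHull-bounded h i =
  subst₂ _≤_ (cong -_ sum-one) (combo i) (proj₁ bounds) , subst₂ _≤_ (combo i) sum-one (proj₂ bounds)
  where
  open InHull h
  bounds = combination-bounded i terms nonneg

0<1-t : ∀ {t} → t < 1ℚ → 0ℚ < 1ℚ - t
0<1-t {t} t<1 = subst (_< 1ℚ - t) (ℚₚ.+-inverseʳ t) (ℚₚ.+-monoˡ-< (- t) t<1)

weighted-sum-maximal : ∀ {t s x y c} → 0ℚ < t → 0ℚ < s → x ≤ c → y ≤ c →
  t * x + s * y ≡ t * c + s * c → x ≡ c
weighted-sum-maximal {t} {s} 0<t 0<s x≤c y≤c eq = ℚₚ.≤-antisym x≤c (ℚₚ.≮⇒≥ λ x<c →
  ℚₚ.<-irrefl eq (ℚₚ.+-mono-<-≤ (ℚₚ.*-monoʳ-<-pos t x<c) (ℚₚ.*-monoˡ-≤-nonNeg s y≤c)))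
  where
  instance
    _ = ℚ.positive 0<t
    _ = ℚ.nonNegative (ℚₚ.<⇒≤ 0<s)

convex-maximal : ∀ {t x y c} → 0ℚ < t → t < 1ℚ → x ≤ c → y ≤ c →
  t * x + (1ℚ - t) * y ≡ c → x ≡ c × y ≡ c
convex-maximal {t} {x} {y} {c} 0<t t<1 x≤c y≤c eq =
  weighted-sum-maximal 0<t 0<s x≤c y≤c eq′ , weighted-sum-maximal 0<s 0<t y≤c x≤c eq″
  where
  0<s = 0<1-t t<1
  split-c : ∀ t c → c ≡ t * c + (1ℚ - t) * c
  split-c = solve 2 (λ t c → c := t :* c :+ (con 1ℚ :- t) :* c) refl
    where open ℚ-Solver.+-*-Solver
  eq′ : t * x + (1ℚ - t) * y ≡ t * c + (1ℚ - t) * c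
  eq′ = trans eq (split-c t c)
  eq″ : (1ℚ - t) * y + t * x ≡ (1ℚ - t) * c + t * c
  eq″ = trans (ℚₚ.+-comm _ (t * x)) (trans eq′ (ℚₚ.+-comm (t * c) _))

convex-minimal : ∀ {t x y c} → 0ℚ < t → t < 1ℚ → c ≤ x → c ≤ y →
  t * x + (1ℚ - t) * y ≡ c → x ≡ c × y ≡ c
convex-minimal {t} {x} {y} {c} 0<t t<1 c≤x c≤y eq =
  Product.map ℚₚ.neg-injective ℚₚ.neg-injective
    (convex-maximal 0<t t<1 (ℚₚ.neg-antimono-≤ c≤x) (ℚₚ.neg-antimono-≤ c≤y)
      (trans (negate t x y) (cong -_ eq)))
  where
  negate : ∀ t x y → t * - x + (1ℚ - t) * - y ≡ - (t * x + (1ℚ - t) * y)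
  negate = solve 3 (λ t x y →
    t :* (:- x) :+ (con 1ℚ :- t) :* (:- y) := :- (t :* x :+ (con 1ℚ :- t) :* y)) refl
    where open ℚ-Solver.+-*-Solver

unit-coordinate-extreme : ∀ {t x y c} → c ≡ 1ℚ ⊎ c ≡ - 1ℚ →
  - 1ℚ ≤ x × x ≤ 1ℚ → - 1ℚ ≤ y × y ≤ 1ℚ →
  0ℚ < t → t < 1ℚ → c ≡ t * x + (1ℚ - t) * y → x ≡ y
unit-coordinate-extreme (inj₁ refl) (_ , x≤1) (_ , y≤1) 0<t t<1 eq =
  let x≡1 , y≡1 = convex-maximal 0<t t<1 x≤1 y≤1 (sym eq) in trans x≡1 (sym y≡1)
unit-coordinate-extreme (inj₂ refl) (-1≤x , _) (-1≤y , _) 0<t t<1 eq =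
  let x≡-1 , y≡-1 = convex-minimal 0<t t<1 -1≤x -1≤y (sym eq) in trans x≡-1 (sym y≡-1)

transversal⇒vertex : ∀ {n} {G : SubE n → Set} {B} → G B → IsTransversal B → IsVertex G (eVec B)
transversal⇒vertex {B = B} B∈G B-transversal = inHull-singleton B∈G , λ x y t x∈ y∈ 0<t t<1 eq i →
  unit-coordinate-extreme (transversal-coordinate {S = B} B-transversal i)
    (inHull-bounded x∈ i) (inHull-bounded y∈ i) 0<t t<1 (eq i)

module _ {n} (M : AntisymmetricMatroid n) where
  open AntisymmetricMatroid M

  record MidpointSplit (B : SubE n) : Set where
    field
      X Y           : SubE n
      X-transversal : TransversalBases M X
      Y-transversal : TransversalBases M Y
      midpoint      : ∀ j → eVec B j ≡ ½ * eVec X j + ½ * eVec Y j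
      separated     : ∃[ j ] eVec X j ≢ eVec Y j

  skewFree-basis⇒transversal : ∀ {S} → 𝓑 S → skewCount S ≡ 0 → IsTransversal S
  skewFree-basis⇒transversal {S} S∈𝓑 noSkew with bases-⊆ S S∈𝓑
  ... | inj₁ transversal   = transversal
  ... | inj₂ (_ , oneSkew) = contradiction (trans (sym noSkew) oneSkew) λ ()

  module AlmostTransversalSplit {B : SubE n} (B∈𝓑 : 𝓑 B) (almost : IsAlmostTransversal B) {p q : Fin n}
    (B[p] : lookup B p ≡ (true , true)) (B[q] : lookup B q ≡ (false , false)) where

    p≢q : p ≢ q
    p≢q p≡q = contradiction (trans (sym B[p]) (trans (cong (lookup B) p≡q) B[q])) λ ()

    open Patch B p≢q

    B-patched : Patched B (true , true) (false , false)
    B-patched = record { at-p = B[p] ; at-q = B[q] ; elsewhere = λ _ _ → refl }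

    skewCount-patched : ∀ {S a b} → Patched S a b → skewCount S ≡ skewWeight a ℕ.+ skewWeight b
    skewCount-patched {S} {a} {b} P = ℕₚ.suc-injective (begin
      suc (skewCount S)                              ≡⟨ patched-count skewWeight P B-patched ⟩
      skewWeight a ℕ.+ skewWeight b ℕ.+ skewCount B  ≡⟨ cong (_ ℕ.+_) (proj₂ almost) ⟩
      skewWeight a ℕ.+ skewWeight b ℕ.+ 1            ≡⟨ ℕₚ.+-comm _ 1 ⟩
      suc (skewWeight a ℕ.+ skewWeight b)            ∎)
      where open ≡-Reasoning

    T : SubE n
    T = insert (q , false) (remove (p , true) B)

    T-patched : Patched T (true , false) (true , false)
    T-patched = patched-updateAt-q (patched-updateAt-p B-patched _) _

    T-transversal : IsTransversal T
    T-transversal =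
      trans (ℕₚ.+-cancelˡ-≡ 2 _ _ (patched-count sizeWeight T-patched B-patched)) (proj₁ almost) ,
      skewCount-patched T-patched

    B′ : SubE n
    B′ = removePair p (addPair q T)

    B′-patched : Patched B′ (false , false) (true , true)
    B′-patched = patched-updateAt-p (patched-updateAt-q T-patched _) _

    B′∈𝓑 : 𝓑 B′
    B′∈𝓑 = Equivalence.to (B2 T T-transversal p q p≢q) (subst 𝓑 (sym B≡T+p-q) B∈𝓑)
      where
      B≡T+p-q : removePair q (addPair p T) ≡ B
      B≡T+p-q = patched-unique (patched-updateAt-q (patched-updateAt-p T-patched _) _) B-patched

    R I : SubE n
    R = remove (p , false) B
    I = insert (p , false) B′

    R-patched : Patched R (false , true) (false , false)
    R-patched = patched-updateAt-p B-patched _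

    I-patched : Patched I (true , false) (true , true)
    I-patched = patched-updateAt-p B′-patched _

    patched-split : ∀ {X Y x y} → Patched X (false , true) x → Patched Y (true , false) y →
      skewWeight x ≡ 0 → skewWeight y ≡ 0 → ev (false , false) ≡ ½ * ev x + ½ * ev y →
      𝓑 X → 𝓑 Y → MidpointSplit B
    patched-split {X} {Y} PX PY x-noSkew y-noSkew mid-q X∈𝓑 Y∈𝓑 = record
      { X             = X
      ; Y             = Y
      ; X-transversal = X∈𝓑 , skewFree-basis⇒transversal X∈𝓑 (trans (skewCount-patched PX) x-noSkew)
      ; Y-transversal = Y∈𝓑 , skewFree-basis⇒transversal Y∈𝓑 (trans (skewCount-patched PY) y-noSkew)
      ; midpoint      = patched-midpoint B-patched PX PY refl mid-q
      ; separated     = p , λ X≡Y → contradiction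
          (trans (sym (cong ev (at-p PX))) (trans X≡Y (cong ev (at-p PY)))) λ ()
      }

    splitAt : ∀ s → 𝓑 (insert (q , s) R) → 𝓑 (remove (q , s) I) → MidpointSplit B
    splitAt false = patched-split (patched-updateAt-q R-patched _) (patched-updateAt-q I-patched _) refl refl refl
    splitAt true  = patched-split (patched-updateAt-q R-patched _) (patched-updateAt-q I-patched _) refl refl refl

    split : MidpointSplit B
    split with Exch B B′ B∈𝓑 B′∈𝓑 (p , false) (cong proj₁ (at-p B-patched)) (cong proj₁ (at-p B′-patched))
                 (skewCount-patched R-patched) (skewCount-patched I-patched)
    ... | (k , s) , k∈B′ , k∉B , X∈𝓑 , Y∈𝓑 with patched-new-element {k = k} {s} B′-patched k∈B′ k∉B
    ... | inj₁ refl = contradiction (trans (sym k∈B′) (gap-∉ s (at-p B′-patched))) λ ()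
    ... | inj₂ refl = splitAt s X∈𝓑 Y∈𝓑

  almostTransversal-split : ∀ {B} → 𝓑 B → IsAlmostTransversal B → MidpointSplit B
  almostTransversal-split {B} B∈𝓑 almost =
    AlmostTransversalSplit.split B∈𝓑 almost
      (proj₂ (almostTransversal-skewPair B almost)) (proj₂ (almostTransversal-gap B almost))

  vertex⇒transversal : ∀ {B} → 𝓑 B → IsVertex 𝓑 (eVec B) → IsTransversal B
  vertex⇒transversal {B} B∈𝓑 (_ , extreme) with bases-⊆ B B∈𝓑
  ... | inj₁ transversal = transversal
  ... | inj₂ almost      = contradiction
    (extreme (eVec X) (eVec Y) ½
      (inHull-singleton (proj₁ X-transversal)) (inHull-singleton (proj₁ Y-transversal))
      (from-yes (0ℚ ℚ.<? ½)) (from-yes (½ ℚ.<? 1ℚ)) midpoint (proj₁ separated))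
    (proj₂ separated)
    where open MidpointSplit (almostTransversal-split B∈𝓑 almost)

  record TransversalRefinement (ts : List (ℚ × SubE n)) : Set where
    field
      terms            : List (ℚ × SubE n)
      all-transversal  : All (λ t → TransversalBases M (proj₂ t)) terms
      nonneg           : NonNegativeWeights terms
      same-weight      : weight terms ≡ weight ts
      same-combination : ∀ i → combination i terms ≡ combination i ts

  prepend : ∀ {ts} l {B} → 𝓑 B → 0ℚ ≤ l →
    TransversalRefinement ts → TransversalRefinement ((l , B) ∷ ts)
  prepend l {B} B∈𝓑 0≤l rest with bases-⊆ B B∈𝓑
  ... | inj₁ B-transversal = record
    { terms            = (l , B) ∷ terms
    ; all-transversal  = (B∈𝓑 , B-transversal) ∷ all-transversal
    ; nonneg           = 0≤l ∷ nonneg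
    ; same-weight      = cong (l +_) same-weight
    ; same-combination = λ i → cong (l * eVec B i +_) (same-combination i)
    }
    where open TransversalRefinement rest
  ... | inj₂ almost = record
    { terms            = (l * ½ , X) ∷ (l * ½ , Y) ∷ terms
    ; all-transversal  = X-transversal ∷ Y-transversal ∷ all-transversal
    ; nonneg           = 0≤l/2 ∷ 0≤l/2 ∷ nonneg
    ; same-weight      = trans (halves-weight l (weight terms)) (cong (l +_) same-weight)
    ; same-combination = λ i → trans (halves-combination l (eVec X i) (eVec Y i) (combination i terms))
                                     (cong₂ (λ b c → l * b + c) (sym (midpoint i)) (same-combination i))
    }
    where
    open TransversalRefinement rest
    open MidpointSplit (almostTransversal-split B∈𝓑 almost)
    open ℚ-Solver.+-*-Solver
    0≤l/2 : 0ℚ ≤ l * ½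
    0≤l/2 = ℚₚ.*-monoʳ-≤-nonNeg ½ 0≤l
    halves-weight : ∀ l w → l * ½ + (l * ½ + w) ≡ l + w
    halves-weight = solve 2 (λ l w → l :* con ½ :+ (l :* con ½ :+ w) := l :+ w) refl
    halves-combination : ∀ l x y c → l * ½ * x + (l * ½ * y + c) ≡ l * (½ * x + ½ * y) + c
    halves-combination = solve 4 (λ l x y c →
      l :* con ½ :* x :+ (l :* con ½ :* y :+ c) := l :* (con ½ :* x :+ con ½ :* y) :+ c) refl

  refine : ∀ ts → All (λ t → 𝓑 (proj₂ t)) ts → NonNegativeWeights ts → TransversalRefinement ts
  refine []             []            []           = record
    { terms = [] ; all-transversal = [] ; nonneg = [] ; same-weight = refl ; same-combination = λ _ → refl }
  refine ((l , B) ∷ ts) (B∈𝓑 ∷ ts∈𝓑) (0≤l ∷ 0≤ts) = prepend l B∈𝓑 0≤l (refine ts ts∈𝓑 0≤ts)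

  inHull-transversal : ∀ {x} → InHull 𝓑 x → InHull (TransversalBases M) x
  inHull-transversal h = record
    { terms   = R.terms
    ; gens    = R.all-transversal
    ; nonneg  = R.nonneg
    ; sum-one = trans R.same-weight sum-one
    ; combo   = λ i → trans (R.same-combination i) (combo i)
    }
    where
    open InHull h
    module R = TransversalRefinement (refine terms gens nonneg)

corollary4p9 : (n : ℕ) (M : AntisymmetricMatroid n) →
  (∀ (B : SubE n) → AntisymmetricMatroid.𝓑 M B →
     IsVertex (AntisymmetricMatroid.𝓑 M) (eVec B) ⇔ IsTransversal B)
  × (∀ (x : Point n) → InHull (AntisymmetricMatroid.𝓑 M) x ⇔ InHull (TransversalBases M) x)
corollary4p9 n M =
  (λ B B∈𝓑 → mk⇔ (vertex⇒transversal M B∈𝓑) (transversal⇒vertex B∈𝓑)) ,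
  (λ x → mk⇔ (inHull-transversal M) (inHull-mono proj₁))
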